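{- Let $t$ be a positive integer and let $C$ be a perfect $t$-deletion code of length $n$ with $t<n$. For any positive integers $a,b$ with $a\le b\le n-t$, $$\mathrm{dS}^t\Big(\bigcup_{a\le r\le b+2t} C_r\Big)\supseteq\bigcup_{a\le r\le b}(\mathbb{B}^{n-t})_r,$$ and consequently $$\sum_{a\le r\le b+2t}\#\mathrm{dS}^t(C_r)\ge 2\sum_{a\le p\le b}\binom{n-t-1}{p-1}.$$
   Context: $\mathbb{B}=\{0,1\}$, $\mathbb{B}^m$ is the set of binary sequences of length $m$. For a binary sequence $\mathbf{x}$, $\|\mathbf{x}\|$ is its number of runs. For a set $X$ of sequences and a positive integer $r$, $X_r=\{\mathbf{x}\in X:\|\mathbf{x}\|=r\}$. $\mathrm{dS}^t(\mathbf{x})$ is the set of sequences obtained from $\mathbf{x}$ by deleting exactly $t$ symbols, and $\mathrm{dS}^t(X)=\bigcup_{\mathbf{x}\in X}\mathrm{dS}^t(\mathbf{x})$. A set $C\subseteq\mathbb{B}^n$ is a $t$-deletion code of length $n$ if $\mathrm{dS}^t(\mathbf{c})\cap\mathrm{dS}^t(\mathbf{d})=\emptyset$ for all distinct $\mathbf{c},\mathbf{d}\in C$; it is perfect if additionally $\mathrm{dS}^t(C)=\mathbb{B}^{n-t}$. $\#X$ is the cardinality of $X$. -}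

module Defs where

open import Data.Bool using (Bool; true; false; if_then_else_)
open import Data.Nat using (ℕ; zero; suc; _+_; _∸_; _≤_; _<_)
open import Data.Vec using (Vec; []; _∷_)
open import Data.List using (List; []; _∷_; _++_; map; filter; length; upTo)
open import Data.Nat.ListAction using (sum)
open import Data.List.Relation.Unary.Any using (Any)
open import Data.List.Membership.Propositional using (_∈_)
open import Data.List.Relation.Unary.Any using (any?)
open import Data.Product using (Σ; ∃; _×_; _,_)
open import Relation.Binary.PropositionalEquality using (_≡_)
open import Relation.Nullary using (Dec; yes; no; ¬_)
open import Relation.Nullary.Decidable using (does; _×-dec_)
import Data.Vec.Properties as VP
import Data.Bool.Properties as BP
import Data.Nat.Properties as NP

𝔹^ : ℕ → Set
𝔹^ m = Vec Bool m

allWords : (m : ℕ) → List (𝔹^ m)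
allWords zero = [] ∷ []
allWords (suc m) = map (false ∷_) (allWords m) ++ map (true ∷_) (allWords m)

-- Number of runs ‖x‖ (maximal blocks of equal symbols); the empty word has 0 runs.
runsFrom : ∀ {m} → Bool → Vec Bool m → ℕ
runsFrom b [] = 0
runsFrom b (c ∷ xs) = (if does (BP._≟_ b c) then 0 else 1) + runsFrom c xs

runs : ∀ {m} → Vec Bool m → ℕ
runs [] = 0
runs (c ∷ xs) = suc (runsFrom c xs)

data Del : ∀ {m k} → ℕ → Vec Bool m → Vec Bool k → Set where
  done : Del 0 [] []
  keep : ∀ {m k t b} {x : Vec Bool m} {y : Vec Bool k} → Del t x y → Del t (b ∷ x) (b ∷ y)
  drop : ∀ {m k t b} {x : Vec Bool m} {y : Vec Bool k} → Del t x y → Del (suc t) (b ∷ x) y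

del? : ∀ {m k} (t : ℕ) (x : Vec Bool m) (y : Vec Bool k) → Dec (Del t x y)
del? zero [] [] = yes done
del? (suc t) [] [] = no (λ ())
del? t [] (_ ∷ _) = no (λ ())
del? zero (b ∷ x) [] = no (λ ())
del? (suc t) (b ∷ x) [] with del? t x []
... | yes p = yes (drop p)
... | no ¬p = no λ { (drop p) → ¬p p }
del? zero (b ∷ x) (c ∷ y) with BP._≟_ b c | del? zero x y
... | yes _≡_.refl | yes p = yes (keep p)
... | yes _≡_.refl | no ¬p = no λ { (keep p) → ¬p p }
... | no b≢c | _ = no λ { (keep p) → b≢c _≡_.refl }
del? (suc t) (b ∷ x) (c ∷ y) with BP._≟_ b c | del? (suc t) x y | del? t x (c ∷ y)
... | _ | _ | yes q = yes (drop q)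
... | yes _≡_.refl | yes p | no _ = yes (keep p)
... | yes _≡_.refl | no ¬p | no ¬q = no λ { (keep p) → ¬p p ; (drop q) → ¬q q }
... | no b≢c | _ | no ¬q = no λ { (keep p) → b≢c _≡_.refl ; (drop q) → ¬q q }

_∈dS[_]_ : ∀ {m k} → Vec Bool k → ℕ → Vec Bool m → Set
y ∈dS[ t ] x = Del t x y

-- A code C ⊆ 𝔹^n, given by a decidable membership predicate (Boolean characteristic function).
Code : ℕ → Set
Code n = 𝔹^ n → Bool

_∈C_ : ∀ {n} → 𝔹^ n → Code n → Set
x ∈C C = C x ≡ true

IsDeletionCode : (n t : ℕ) → Code n → Set
IsDeletionCode n t C =
  ∀ (c d : 𝔹^ n) → c ∈C C → d ∈C C → ¬ (c ≡ d) →
  ∀ (y : 𝔹^ (n ∸ t)) → ¬ (Del t c y × Del t d y)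

IsPerfectDeletionCode : (n t : ℕ) → Code n → Set
IsPerfectDeletionCode n t C =
  IsDeletionCode n t C ×
  (∀ (y : 𝔹^ (n ∸ t)) → ∃ λ (c : 𝔹^ n) → c ∈C C × Del t c y)

-- y ∈ dS^t(X) where X = {c ∈ C : lo ≤ ‖c‖ ≤ hi}  (covers C_r with lo = hi = r).
InDS : ∀ {n k} (t : ℕ) → Code n → (lo hi : ℕ) → 𝔹^ k → Set
InDS {n} t C lo hi y = ∃ λ (c : 𝔹^ n) → c ∈C C × lo ≤ runs c × runs c ≤ hi × Del t c y

inDS? : ∀ {n k} (t : ℕ) (C : Code n) (lo hi : ℕ) (y : 𝔹^ k) →
        Dec (Any (λ c → c ∈C C × lo ≤ runs c × runs c ≤ hi × Del t c y) (allWords n))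
inDS? {n} t C lo hi y =
  any? (λ c → (BP._≟_ (C c) true) ×-dec ((lo NP.≤? runs c) ×-dec ((runs c NP.≤? hi) ×-dec del? t c y)))
       (allWords n)

#dS : ∀ {n} (t : ℕ) → Code n → (r : ℕ) → ℕ
#dS {n} t C r = length (filter (inDS? t C r r) (allWords (n ∸ t)))

sumRange : ℕ → ℕ → (ℕ → ℕ) → ℕ
sumRange lo hi f = sum (map (λ i → f (lo + i)) (upTo (suc hi ∸ lo)))

module Submission where

-- Deleting one symbol from a binary word never increases the number of runs
-- and lowers it by at most two.  Hence if y ∈ dS^t(c) then
-- ‖y‖ ≤ ‖c‖ ≤ ‖y‖ + 2t.  Since a perfect code covers every y ∈ 𝔹^{n-t},
-- each y with a ≤ ‖y‖ ≤ b lies in dS^t(C_r) for some r ∈ [a, b+2t]: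
-- this is the first claim.
--
-- For the counting claim we double count pairs (r, y).  Writing the
-- right-hand side as Σ_{a ≤ p ≤ b} #{y : ‖y‖ = p} (there are 2·C(m-1,p-1)
-- words of length m with p runs), both sides become sums over y ∈ 𝔹^{n-t}
-- of the number of layers "hit" by y; a word is hit by at most one
-- run-layer p, and whenever it is, the first claim gives a code layer r.

open import Defs
open import Data.Nat using (ℕ; _≤_; _≥_; _<_; _+_; _*_; _∸_)
open import Data.Nat.Combinatorics using (_C_)
open import Data.Product using (_×_)

open import Data.Bool using (Bool; true; false; if_then_else_)
import Data.Bool.Properties as Bool
open import Data.List using (List; []; _∷_; _++_; map; filter; length; upTo)
open import Data.List.Membership.Propositional using (_∈_; find; lose)
open import Data.List.Membership.Propositional.Properties
  using (∈-map⁺; ∈-++⁺ˡ; ∈-++⁺ʳ; ∈-upTo⁺; ∈-upTo⁻)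
open import Data.List.Properties using (map-++; map-∘; filter-some; filter-none)
open import Data.List.Relation.Unary.All using (All; []; _∷_)
open import Data.List.Relation.Unary.All.Properties using (all-filter)
open import Data.List.Relation.Unary.All.Properties.Core using (¬Any⇒All¬)
open import Data.List.Relation.Unary.AllPairs using ([]; _∷_)
open import Data.List.Relation.Unary.Any using (Any; any?)
open import Data.List.Relation.Unary.Unique.Propositional using (Unique)
import Data.List.Relation.Unary.Unique.Propositional.Properties as Unique
open import Data.Nat using (zero; suc; z≤n; s≤s; s≤s⁻¹; _≟_)
open import Data.Nat.Combinatorics using (nCk+nC[k+1]≡[n+1]C[k+1])
open import Data.Nat.ListAction using (sum)
open import Data.Nat.ListAction.Properties using (sum-++)
open import Data.Nat.Properties
open import Algebra.Properties.CommutativeSemigroup +-commutativeSemigroup using (interchange)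
open import Data.Nat.Tactic.RingSolver using (solve-∀)
open import Data.Product using (_,_)
open import Data.Vec using ([]; _∷_)
open import Function using (_∘_)
open import Relation.Binary.PropositionalEquality
open import Relation.Nullary using (Dec; does; yes; no; contradiction)
open import Relation.Unary using (Decidable)

private
  variable
    A B : Set

Σ : List A → (A → ℕ) → ℕ
Σ xs f = sum (map f xs)

count : {P : A → Set} → Decidable P → List A → ℕ
count P? xs = length (filter P? xs)

indicator : {P : Set} → Dec P → ℕ
indicator d = if does d then 1 else 0

Σ-cong : (xs : List A) {f g : A → ℕ} → (∀ x → f x ≡ g x) → Σ xs f ≡ Σ xs g
Σ-cong []       f≡g = refl
Σ-cong (x ∷ xs) f≡g = cong₂ _+_ (f≡g x) (Σ-cong xs f≡g)

Σ-mono : (xs : List A) {f g : A → ℕ} → (∀ x → f x ≤ g x) → Σ xs f ≤ Σ xs g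
Σ-mono []       f≤g = z≤n
Σ-mono (x ∷ xs) f≤g = +-mono-≤ (f≤g x) (Σ-mono xs f≤g)

Σ-zero : (xs : List A) → Σ xs (λ _ → 0) ≡ 0
Σ-zero []       = refl
Σ-zero (_ ∷ xs) = Σ-zero xs

Σ-+ : (xs : List A) (f g : A → ℕ) → Σ xs (λ x → f x + g x) ≡ Σ xs f + Σ xs g
Σ-+ []       f g = refl
Σ-+ (x ∷ xs) f g = trans (cong (f x + g x +_) (Σ-+ xs f g)) (interchange (f x) (g x) _ _)

Σ-scale : (k : ℕ) (xs : List A) (f : A → ℕ) → Σ xs (λ x → k * f x) ≡ k * Σ xs f
Σ-scale k []       f = sym (*-zeroʳ k)
Σ-scale k (x ∷ xs) f = trans (cong (k * f x +_) (Σ-scale k xs f)) (sym (*-distribˡ-+ k (f x) _))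

Σ-++ : (xs ys : List A) (f : A → ℕ) → Σ (xs ++ ys) f ≡ Σ xs f + Σ ys f
Σ-++ xs ys f = trans (cong sum (map-++ f xs ys)) (sum-++ (map f xs) (map f ys))

Σ-map : (g : A → B) (xs : List A) (f : B → ℕ) → Σ (map g xs) f ≡ Σ xs (f ∘ g)
Σ-map g xs f = cong sum (sym (map-∘ xs))

Σ-swap : (xs : List A) (ys : List B) (F : A → B → ℕ) →
         Σ xs (λ x → Σ ys (F x)) ≡ Σ ys (λ y → Σ xs (λ x → F x y))
Σ-swap []       ys F = sym (Σ-zero ys)
Σ-swap (x ∷ xs) ys F = trans (cong (Σ ys (F x) +_) (Σ-swap xs ys F))
                             (sym (Σ-+ ys (F x) (λ y → Σ xs (λ x′ → F x′ y))))

count-as-Σ : {P : A → Set} (P? : Decidable P) (xs : List A) →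
             count P? xs ≡ Σ xs (λ x → indicator (P? x))
count-as-Σ P? []       = refl
count-as-Σ P? (x ∷ xs) with does (P? x)
... | true  = cong suc (count-as-Σ P? xs)
... | false = count-as-Σ P? xs

double-count : {P : A → B → Set} (P? : ∀ i y → Dec (P i y)) (I : List A) (W : List B) →
               Σ I (λ i → count (P? i) W) ≡ Σ W (λ y → count (λ i → P? i y) I)
double-count P? I W = begin
  Σ I (λ i → count (P? i) W)
    ≡⟨ Σ-cong I (λ i → count-as-Σ (P? i) W) ⟩
  Σ I (λ i → Σ W (λ y → indicator (P? i y)))
    ≡⟨ Σ-swap I W (λ i y → indicator (P? i y)) ⟩
  Σ W (λ y → Σ I (λ i → indicator (P? i y)))
    ≡⟨ Σ-cong W (λ y → count-as-Σ (λ i → P? i y) I) ⟨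
  Σ W (λ y → count (λ i → P? i y) I)
    ∎
  where open ≡-Reasoning

count-unique≤1 : {P : A → Set} (P? : Decidable P) → (∀ {x y} → P x → P y → x ≡ y) →
                 {xs : List A} → Unique xs → count P? xs ≤ 1
count-unique≤1 {A = A} {P = P} P? functional {xs} unique =
  length≤1 (Unique.filter⁺ P? unique) (all-filter P? xs)
  where
  length≤1 : {ys : List A} → Unique ys → All P ys → length ys ≤ 1
  length≤1 []                          _                = z≤n
  length≤1 (_ ∷ [])                    _                = s≤s z≤n
  length≤1 ((x≢y ∷ _) ∷ _) (px ∷ py ∷ _) = contradiction (functional px py) x≢y

count-≤ : {P Q : A → Set} (P? : Decidable P) (Q? : Decidable Q) {xs ys : List A} →
          count P? xs ≤ 1 → (Any P xs → Any Q ys) → count P? xs ≤ count Q? ys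
count-≤ P? Q? {xs} at-most-one hit with any? P? xs
... | yes p = ≤-trans at-most-one (filter-some Q? (hit p))
... | no ¬p = ≤-trans (≤-reflexive (cong length (filter-none P? (¬Any⇒All¬ xs ¬p)))) z≤n

allWords-complete : ∀ {m} (x : 𝔹^ m) → x ∈ allWords m
allWords-complete []          = Any.here refl
allWords-complete (false ∷ x) = ∈-++⁺ˡ (∈-map⁺ (false ∷_) (allWords-complete x))
allWords-complete {suc m} (true ∷ x) =
  ∈-++⁺ʳ (map (false ∷_) (allWords m)) (∈-map⁺ (true ∷_) (allWords-complete x))

Σ-allWords-suc : (m : ℕ) (f : 𝔹^ (suc m) → ℕ) →
                 Σ (allWords (suc m)) f ≡ Σ (allWords m) (f ∘ (false ∷_)) + Σ (allWords m) (f ∘ (true ∷_))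
Σ-allWords-suc m f =
  trans (Σ-++ (map (false ∷_) (allWords m)) _ f)
        (cong₂ _+_ (Σ-map (false ∷_) (allWords m) f) (Σ-map (true ∷_) (allWords m) f))

-- Runs under deletions.
-- runsFrom b x counts the symbol changes of x read after a virtual symbol b,
-- so runsFrom b (c ∷ x) = change b c + runsFrom c x holds by definition.

change : Bool → Bool → ℕ
change b c = if does (b Bool.≟ c) then 0 else 1

change≤1 : ∀ b c → change b c ≤ 1
change≤1 false false = z≤n
change≤1 false true  = s≤s z≤n
change≤1 true  false = s≤s z≤n
change≤1 true  true  = z≤n

change-triangle : ∀ b d e → change b e ≤ change b d + change d e
change-triangle false false e     = ≤-refl
change-triangle false true  false = z≤n
change-triangle false true  true  = s≤s z≤n
change-triangle true  false false = s≤s z≤n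
change-triangle true  false true  = z≤n
change-triangle true  true  e     = ≤-refl

runsFrom-shift : ∀ {k} b d (y : 𝔹^ k) → runsFrom b y ≤ change b d + runsFrom d y
runsFrom-shift b d []      = z≤n
runsFrom-shift b d (e ∷ z) =
  ≤-trans (+-monoˡ-≤ (runsFrom e z) (change-triangle b d e))
          (≤-reflexive (+-assoc (change b d) (change d e) (runsFrom e z)))

runsFrom≤runs : ∀ {k} c (y : 𝔹^ k) → runsFrom c y ≤ runs y
runsFrom≤runs c []      = z≤n
runsFrom≤runs c (d ∷ z) = +-monoˡ-≤ (runsFrom d z) (change≤1 c d)

runs≤1+runsFrom : ∀ {k} c (y : 𝔹^ k) → runs y ≤ suc (runsFrom c y)
runs≤1+runsFrom c []      = z≤n
runs≤1+runsFrom c (d ∷ z) = s≤s (m≤n+m (runsFrom d z) (change c d))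

-- The budget 2t grows by two with each further deletion.
two-more-deletions : ∀ r t → 2 + (r + 2 * t) ≡ r + 2 * suc t
two-more-deletions = solve-∀

deletion-runsFrom-lower : ∀ {m k t} {x : 𝔹^ m} {y : 𝔹^ k} → Del t x y →
                          ∀ b → runsFrom b y ≤ runsFrom b x
deletion-runsFrom-lower done b = z≤n
deletion-runsFrom-lower (keep {b = c} p) b = +-monoʳ-≤ (change b c) (deletion-runsFrom-lower p c)
deletion-runsFrom-lower (drop {b = c} {y = y} p) b =
  ≤-trans (runsFrom-shift b c y) (+-monoʳ-≤ (change b c) (deletion-runsFrom-lower p c))

deletion-runsFrom-upper : ∀ {m k t} {x : 𝔹^ m} {y : 𝔹^ k} → Del t x y →
                          ∀ b → runsFrom b x ≤ runsFrom b y + 2 * t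
deletion-runsFrom-upper done b = z≤n
deletion-runsFrom-upper {t = t} (keep {b = c} {y = y} p) b =
  ≤-trans (+-monoʳ-≤ (change b c) (deletion-runsFrom-upper p c))
          (≤-reflexive (sym (+-assoc (change b c) (runsFrom c y) (2 * t))))
deletion-runsFrom-upper (drop {t = t} {b = c} {x = x} {y = y} p) b = begin
  change b c + runsFrom c x
    ≤⟨ +-monoʳ-≤ (change b c) (deletion-runsFrom-upper p c) ⟩
  change b c + (runsFrom c y + 2 * t)
    ≤⟨ +-monoʳ-≤ (change b c) (+-monoˡ-≤ (2 * t) (runsFrom-shift c b y)) ⟩
  change b c + ((change c b + runsFrom b y) + 2 * t)
    ≤⟨ +-mono-≤ (change≤1 b c) (+-monoˡ-≤ (2 * t) (+-monoˡ-≤ (runsFrom b y) (change≤1 c b))) ⟩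
  2 + (runsFrom b y + 2 * t)
    ≡⟨ two-more-deletions (runsFrom b y) t ⟩
  runsFrom b y + 2 * suc t
    ∎
  where open ≤-Reasoning

deletion-runs-lower : ∀ {m k t} {x : 𝔹^ m} {y : 𝔹^ k} → Del t x y → runs y ≤ runs x
deletion-runs-lower done             = z≤n
deletion-runs-lower (keep {b = c} p) = s≤s (deletion-runsFrom-lower p c)
deletion-runs-lower (drop {b = c} {y = y} p) =
  ≤-trans (runs≤1+runsFrom c y) (s≤s (deletion-runsFrom-lower p c))

deletion-runs-upper : ∀ {m k t} {x : 𝔹^ m} {y : 𝔹^ k} → Del t x y → runs x ≤ runs y + 2 * t
deletion-runs-upper done             = z≤n
deletion-runs-upper (keep {b = c} p) = s≤s (deletion-runsFrom-upper p c)
deletion-runs-upper (drop {t = t} {b = c} {x = x} {y = y} p) = begin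
  suc (runsFrom c x)              ≤⟨ s≤s (deletion-runsFrom-upper p c) ⟩
  suc (runsFrom c y + 2 * t)      ≤⟨ s≤s (+-monoˡ-≤ (2 * t) (runsFrom≤runs c y)) ⟩
  suc (runs y + 2 * t)            ≤⟨ n≤1+n _ ⟩
  2 + (runs y + 2 * t)            ≡⟨ two-more-deletions (runs y) t ⟩
  runs y + 2 * suc t              ∎
  where open ≤-Reasoning

runsFrom-count : ∀ m b k → Σ (allWords m) (λ x → indicator (runsFrom b x ≟ k)) ≡ m C k
runsFrom-count zero    b zero    = refl
runsFrom-count zero    b (suc k) = refl
runsFrom-count (suc m) b k =
  trans (Σ-allWords-suc m (λ x → indicator (runsFrom b x ≟ k))) (split b k)
  where
  W = allWords m
  split : ∀ b k → Σ W (λ x → indicator (change b false + runsFrom false x ≟ k))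
                + Σ W (λ x → indicator (change b true + runsFrom true x ≟ k)) ≡ suc m C k
  split false zero    = cong₂ _+_ (runsFrom-count m false 0) (Σ-zero W)
  split true  zero    = cong₂ _+_ (Σ-zero W) (runsFrom-count m true 0)
  split false (suc k) = begin
    Σ W (λ x → indicator (runsFrom false x ≟ suc k)) + Σ W (λ x → indicator (runsFrom true x ≟ k))
      ≡⟨ cong₂ _+_ (runsFrom-count m false (suc k)) (runsFrom-count m true k) ⟩
    m C suc k + m C k  ≡⟨ +-comm (m C suc k) (m C k) ⟩
    m C k + m C suc k  ≡⟨ nCk+nC[k+1]≡[n+1]C[k+1] m k ⟩
    suc m C suc k      ∎
    where open ≡-Reasoning
  split true (suc k) =
    trans (cong₂ _+_ (runsFrom-count m false k) (runsFrom-count m true (suc k)))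
          (nCk+nC[k+1]≡[n+1]C[k+1] m k)

runs-count : ∀ M → 1 ≤ M → ∀ q → count (λ y → runs y ≟ suc q) (allWords M) ≡ 2 * ((M ∸ 1) C q)
runs-count (suc m) _ q = begin
  count (λ y → runs y ≟ suc q) (allWords (suc m))
    ≡⟨ count-as-Σ (λ y → runs y ≟ suc q) (allWords (suc m)) ⟩
  Σ (allWords (suc m)) (λ y → indicator (runs y ≟ suc q))
    ≡⟨ Σ-allWords-suc m (λ y → indicator (runs y ≟ suc q)) ⟩
  Σ (allWords m) (λ x → indicator (runsFrom false x ≟ q))
    + Σ (allWords m) (λ x → indicator (runsFrom true x ≟ q))
    ≡⟨ cong₂ _+_ (runsFrom-count m false q) (runsFrom-count m true q) ⟩
  m C q + m C q
    ≡⟨ cong (m C q +_) (sym (+-identityʳ (m C q))) ⟩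
  2 * (m C q) ∎
  where open ≡-Reasoning

InLayer : ∀ {n} (t : ℕ) → Code n → ℕ → 𝔹^ (n ∸ t) → Set
InLayer {n} t 𝒞 r y = Any (λ c → c ∈C 𝒞 × r ≤ runs c × runs c ≤ r × Del t c y) (allWords n)

perfect-cover : ∀ n t (𝒞 : Code n) → IsPerfectDeletionCode n t 𝒞 →
                ∀ a b (y : 𝔹^ (n ∸ t)) → a ≤ runs y → runs y ≤ b → InDS t 𝒞 a (b + 2 * t) y
perfect-cover n t 𝒞 (_ , covers) a b y a≤y y≤b with covers y
... | c , c∈𝒞 , del =
  c , c∈𝒞 , ≤-trans a≤y (deletion-runs-lower del) ,
  ≤-trans (deletion-runs-upper del) (+-monoˡ-≤ (2 * t) y≤b) , del

window-bound : ∀ {lo hi i} → lo ≤ hi → i < suc hi ∸ lo → lo + i ≤ hi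
window-bound {lo} {hi} {i} lo≤hi i<w = s≤s⁻¹ (begin-strict
  lo + i              <⟨ +-monoʳ-< lo i<w ⟩
  lo + (suc hi ∸ lo)  ≡⟨ m+[n∸m]≡n (m≤n⇒m≤1+n lo≤hi) ⟩
  suc hi              ∎)
  where open ≤-Reasoning

layer-hit : ∀ n t (𝒞 : Code n) → IsPerfectDeletionCode n t 𝒞 → ∀ a b → a ≤ b →
            (y : 𝔹^ (n ∸ t)) → Any (λ i → runs y ≡ a + i) (upTo (suc b ∸ a)) →
            Any (λ j → InLayer t 𝒞 (a + j) y) (upTo (suc (b + 2 * t) ∸ a))
layer-hit n t 𝒞 perfect a b a≤b y hit with find hit
... | i , i∈ , y≡a+i
    with perfect-cover n t 𝒞 perfect a b y (subst (a ≤_) (sym y≡a+i) (m≤m+n a i))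
                                           (subst (_≤ b) (sym y≡a+i) (window-bound a≤b (∈-upTo⁻ i∈)))
... | c , c∈𝒞 , a≤c , c≤b+2t , del =
  lose (∈-upTo⁺ (∸-monoˡ-< (s≤s c≤b+2t) a≤c))
       (lose (allWords-complete c) (c∈𝒞 , ≤-reflexive a+j≡c , ≤-reflexive (sym a+j≡c) , del))
  where
  a+j≡c : a + (runs c ∸ a) ≡ runs c
  a+j≡c = m+[n∸m]≡n a≤c

lemma9 : (n t : ℕ) → 1 ≤ t → t < n → (𝒞 : Code n) → IsPerfectDeletionCode n t 𝒞 →
    (a b : ℕ) → 1 ≤ a → a ≤ b → b ≤ n ∸ t →
    ((y : 𝔹^ (n ∸ t)) → a ≤ runs y → runs y ≤ b → InDS t 𝒞 a (b + 2 * t) y)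
    × (sumRange a (b + 2 * t) (λ r → #dS t 𝒞 r)
        ≥ (2 * sumRange a b (λ p → (n ∸ t ∸ 1) C (p ∸ 1))))
lemma9 n t _ t<n 𝒞 perfect a@(suc a′) b (s≤s z≤n) a≤b _ = perfect-cover n t 𝒞 perfect a b , counting
  where
  W : List (𝔹^ (n ∸ t))
  W = allWords (n ∸ t)
  runsWindow codeWindow : List ℕ
  runsWindow = upTo (suc b ∸ a)
  codeWindow = upTo (suc (b + 2 * t) ∸ a)
  run-layer? : (y : 𝔹^ (n ∸ t)) (i : ℕ) → Dec (runs y ≡ a + i)
  code-layer? : (y : 𝔹^ (n ∸ t)) (j : ℕ) → Dec (InLayer t 𝒞 (a + j) y)
  run-layer? y i = runs y ≟ a + i
  code-layer? y j = inDS? t 𝒞 (a + j) (a + j) y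
  -- Each word lies in at most one run layer, and then in some code layer.
  per-word : (y : 𝔹^ (n ∸ t)) → count (run-layer? y) runsWindow ≤ count (code-layer? y) codeWindow
  per-word y = count-≤ (run-layer? y) (code-layer? y)
    (count-unique≤1 (run-layer? y) (λ e e′ → +-cancelˡ-≡ a _ _ (trans (sym e) e′)) (Unique.upTo⁺ (suc b ∸ a)))
    (layer-hit n t 𝒞 perfect a b a≤b y)
  counting : sumRange a (b + 2 * t) (λ r → #dS t 𝒞 r) ≥ 2 * sumRange a b (λ p → (n ∸ t ∸ 1) C (p ∸ 1))
  counting = begin
    2 * Σ runsWindow (λ i → (n ∸ t ∸ 1) C (a′ + i))
      ≡⟨ Σ-scale 2 runsWindow _ ⟨
    Σ runsWindow (λ i → 2 * ((n ∸ t ∸ 1) C (a′ + i)))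
      ≡⟨ Σ-cong runsWindow (λ i → runs-count (n ∸ t) (m<n⇒0<n∸m t<n) (a′ + i)) ⟨
    Σ runsWindow (λ i → count (λ y → run-layer? y i) W)
      ≡⟨ double-count (λ i y → run-layer? y i) runsWindow W ⟩
    Σ W (λ y → count (run-layer? y) runsWindow)
      ≤⟨ Σ-mono W per-word ⟩
    Σ W (λ y → count (code-layer? y) codeWindow)
      ≡⟨ double-count (λ j y → code-layer? y j) codeWindow W ⟨
    sumRange a (b + 2 * t) (λ r → #dS t 𝒞 r)
      ∎
    where open ≤-Reasoning
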